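{- Let $\mathcal{E}_0\trianglelefteq\mathcal{E}_1\trianglelefteq\mathcal{E}_2\trianglelefteq\cdots$ be an increasing sequence of bundle event structures with limit $\bigcup_i\mathcal{E}_i$. Then $\mathcal{L}(\bigcup_i\mathcal{E}_i)=\bigcup_{i\in\mathbb{N}}\mathcal{L}(\mathcal{E}_i)$.
   Context: A bundle event structure (BES) is $\mathcal{E}=(E,\#,\mapsto,\lambda,\Phi)$: $E$ a set of events; $\#\subseteq E\times E$ irreflexive symmetric; for $x,y\subseteq E$, $x\#y$ means $e\#f$ for all $e\in x,f\in y$ with $e\neq f$; $\mapsto\subseteq\mathcal{P}(E)\times E$ with $x\mapsto e\Rightarrow x\#x$; $\lambda:E\to\Sigma$ a partial labelling; $\Phi\subseteq E$ with $\Phi\#\Phi$. Let $\mathrm{cfl}(x)=\{e\mid\exists e'\in x:e\#e'\}$. An event trace is a finite sequence $e_1\cdots e_n$ such that for each $i$, $e_i\notin\mathrm{cfl}(\{e_1,\dots,e_{i-1}\})\cup\{e_1,\dots,e_{i-1}\}$ and for each bundle $z\mapsto e_i$ there is $j<i$ with $e_j\in z$. A configuration is the set of events of an event trace; $\mathcal{C}(\mathcal{E})$ is the set of configurations. For $x\in\mathcal{C}(\mathcal{E})$ its lposet is $(x,\preceq_x,\lambda|_x)$, where $\preceq_x$ is the intersection over all event traces enumerating $x$ of the reflexive-transitive closures of their sequence orders; $\mathcal{L}(\mathcal{E})$ is the set of these lposets. Sub-BES order: $\mathcal{E}\trianglelefteq\mathcal{E}'$ iff $E\subseteq E'$, $\#=\#'\cap(E\times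 E)$, $\mapsto\subseteq\mapsto'$, ($x\mapsto'e$ and $e\in E$) implies ($x\subseteq E$ and $x\mapsto e$), $\lambda=\lambda'|_E$, $\Phi=\Phi'\cap E$. The limit $\bigcup_i\mathcal{E}_i$ of an increasing chain is the BES $(\bigcup_iE_i,\bigcup_i\#_i,\bigcup_i\mapsto_i,\bigcup_i\lambda_i,\bigcup_i\Phi_i)$, which is its least upper bound for $\trianglelefteq$. -}

module Defs where

open import Data.Nat using (ℕ; suc; _<_)
open import Data.Fin using (Fin; toℕ)
open import Data.List using (List; []; _∷ʳ_; length; lookup)
open import Data.List.Membership.Propositional using (_∈_; _∉_)
open import Data.Product using (Σ; ∃; ∃-syntax; _×_; _,_)
open import Data.Sum using (_⊎_)
open import Relation.Nullary using (¬_)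
open import Relation.Binary.PropositionalEquality using (_≡_; _≢_)
open import Function.Bundles using (_⇔_)

Subset : Set → Set₁
Subset U = U → Set

-- The partial labelling λ : E ⇀ A is given as a functional relation
-- (lab e a  means  λ(e) = a).
record BES (U A : Set) : Set₁ where
  field
    E    : Subset U
    _#_  : U → U → Set
    _↦_  : Subset U → U → Set
    lab  : U → A → Set
    Φ    : Subset U
    #-in-E     : ∀ {e f} → e # f → E e × E f
    ↦-target-E : ∀ {x e} → x ↦ e → E e
    ↦-source-E : ∀ {x e} → x ↦ e → ∀ f → x f → E f
    lab-in-E   : ∀ {e a} → lab e a → E e
    lab-func   : ∀ {e a b} → lab e a → lab e b → a ≡ b
    Φ-in-E     : ∀ {e} → Φ e → E e
    #-irrefl   : ∀ {e} → ¬ (e # e)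
    #-sym      : ∀ {e f} → e # f → f # e
    ↦-conflict : ∀ {x e} → x ↦ e → ∀ f g → x f → x g → f ≢ g → f # g
    Φ-conflict : ∀ f g → Φ f → Φ g → f ≢ g → f # g

module _ {U A : Set} (ℰ : BES U A) where
  open BES ℰ

  data IsTrace : List U → Set₁ where
    []ᵗ  : IsTrace []
    step : ∀ {σ e} → IsTrace σ → E e → e ∉ σ
         → (∀ e' → e' ∈ σ → ¬ (e # e'))
         → (∀ z → z ↦ e → ∃[ e' ] (e' ∈ σ × z e'))
         → IsTrace (σ ∷ʳ e)

  Enumerates : List U → Subset U → Set
  Enumerates σ x = ∀ e → (x e ⇔ e ∈ σ)

  IsConfig : Subset U → Set₁
  IsConfig x = ∃[ σ ] (IsTrace σ × Enumerates σ x)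

  SeqLe : List U → U → U → Set
  SeqLe σ a b = a ≡ b
    ⊎ ∃[ i ] ∃[ j ] (toℕ {length σ} i < toℕ j × lookup σ i ≡ a × lookup σ j ≡ b)

  Prec : Subset U → U → U → Set₁
  Prec x a b = ∀ σ → IsTrace σ → Enumerates σ x → SeqLe σ a b

record LPoset (U A : Set) : Set₁ where
  field
    carrier : Subset U
    order   : U → U → Set
    label   : U → A → Set

-- P ∈ 𝓛(ℰ): P is the lposet (x, ≼_x, λ|_x) of some configuration x
-- (compared extensionally on the carrier x).
_∈𝓛_ : {U A : Set} → LPoset U A → BES U A → Set₁
P ∈𝓛 ℰ = IsConfig ℰ carrier
       × (∀ a b → carrier a → carrier b → (order a b → Prec ℰ carrier a b)
                                         × (Prec ℰ carrier a b → order a b))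
       × (∀ a l → carrier a → (label a l ⇔ BES.lab ℰ a l))
  where open LPoset P

record _⊴_ {U A : Set} (ℰ ℰ' : BES U A) : Set₁ where
  module S = BES ℰ
  module T = BES ℰ'
  field
    E⊆    : ∀ e → S.E e → T.E e
    #-res : ∀ e f → S.E e → S.E f → (S._#_ e f ⇔ T._#_ e f)
    ↦⊆    : ∀ x e → S._↦_ x e → T._↦_ x e
    ↦-res : ∀ x e → T._↦_ x e → S.E e → (∀ f → x f → S.E f) × S._↦_ x e
    lab-res : ∀ e a → S.E e → (S.lab e a ⇔ T.lab e a)
    Φ-res : ∀ e → (S.Φ e ⇔ (T.Φ e × S.E e))

record IsLimit {U A : Set} (𝓔 : ℕ → BES U A) (ℒ : BES U A) : Set₁ where
  module L = BES ℒ
  module C (i : ℕ) = BES (𝓔 i)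
  field
    E-lim   : ∀ e → (L.E e ⇔ (∃[ i ] C.E i e))
    #-lim   : ∀ e f → (L._#_ e f ⇔ (∃[ i ] C._#_ i e f))
    ↦-lim   : ∀ x e → (L._↦_ x e ⇔ (∃[ i ] C._↦_ i x e))
    lab-lim : ∀ e a → (L.lab e a ⇔ (∃[ i ] C.lab i e a))
    Φ-lim   : ∀ e → (L.Φ e ⇔ (∃[ i ] C.Φ i e))

module Submission where

-- The proof rests on one observation: two BESs related by ⊴ (in either
-- direction) agree on conflict, bundles, labelling and Φ for every event
-- they share.  Consequently an event trace using only shared events is a
-- trace of one structure iff it is one of the other, and an lposet whose
-- carrier consists of shared events belongs to 𝓛 of one iff it belongs
-- to 𝓛 of the other (∈𝓛-transfer).
--
-- For a chain 𝓔 we show that it is monotone (𝓔 i ⊴ 𝓔 j for i ≤ j, using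
-- that ⊴ is a preorder) and that every member is below the limit ℒ.  An
-- lposet of some 𝓔 i is then an lposet of ℒ directly.  Conversely, an
-- lposet of ℒ comes from a finite trace, which already lies inside a
-- single 𝓔 i because the event sets form an increasing chain; transfer
-- along 𝓔 i ⊴ ℒ concludes.

open import Defs
open import Data.Nat using (ℕ; zero; suc; _≤_; _⊔_)
open import Data.Nat.Properties using (≤-total; ≤⇒≤′; m≤m⊔n; m≤n⊔m)
open import Data.Nat.Base using (_≤′_; ≤′-refl; ≤′-step)
open import Data.Product using (∃-syntax; _,_; proj₁; proj₂)
open import Data.Sum using (_⊎_; inj₁; inj₂; swap)
open import Data.List using (List; []; _∷_)
open import Data.List.Relation.Unary.Any using (here; there)
open import Data.List.Membership.Propositional using (_∈_)
open import Data.List.Membership.Propositional.Properties using (∈-++⁺ˡ; ∈-++⁺ʳ; ∈-++⁻)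
open import Relation.Binary.PropositionalEquality using (refl)
open import Function.Bundles using (_⇔_; mk⇔; Equivalence)
open Equivalence using (to; from)
open import Function.Construct.Composition using (_⇔-∘_)
open import Function.Construct.Identity using (⇔-id)

_⊆_ : {U : Set} → Subset U → Subset U → Set
X ⊆ Y = ∀ e → X e → Y e

trace-in-E : {U A : Set} (ℰ : BES U A) {σ : List U} → IsTrace ℰ σ → (_∈ σ) ⊆ BES.E ℰ
trace-in-E ℰ []ᵗ e ()
trace-in-E ℰ (step {σ} tr Ef _ _ _) e m with ∈-++⁻ σ m
... | inj₁ m' = trace-in-E ℰ tr e m'
... | inj₂ (here refl) = Ef

config-in-E : {U A : Set} (ℰ : BES U A) {x : Subset U} → IsConfig ℰ x → x ⊆ BES.E ℰ
config-in-E ℰ (σ , tr , en) e xe = trace-in-E ℰ tr e (to (en e) xe)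

⊴-refl : {U A : Set} {ℰ : BES U A} → ℰ ⊴ ℰ
⊴-refl {ℰ = ℰ} = record
  { E⊆     = λ e h → h
  ; #-res  = λ e f _ _ → ⇔-id _
  ; ↦⊆     = λ x e h → h
  ; ↦-res  = λ x e h _ → ↦-source-E h , h
  ; lab-res = λ e a _ → ⇔-id _
  ; Φ-res  = λ e → mk⇔ (λ h → h , Φ-in-E h) proj₁
  }
  where open BES ℰ

⊴-trans : {U A : Set} {ℰ₁ ℰ₂ ℰ₃ : BES U A} → ℰ₁ ⊴ ℰ₂ → ℰ₂ ⊴ ℰ₃ → ℰ₁ ⊴ ℰ₃
⊴-trans ext₁₂ ext₂₃ = record
  { E⊆     = λ e h → R₂₃.E⊆ e (R₁₂.E⊆ e h)
  ; #-res  = λ e f Ee Ef →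
      R₂₃.#-res e f (R₁₂.E⊆ e Ee) (R₁₂.E⊆ f Ef) ⇔-∘ R₁₂.#-res e f Ee Ef
  ; ↦⊆     = λ x e h → R₂₃.↦⊆ x e (R₁₂.↦⊆ x e h)
  ; ↦-res  = λ x e h Ee → R₁₂.↦-res x e (proj₂ (R₂₃.↦-res x e h (R₁₂.E⊆ e Ee))) Ee
  ; lab-res = λ e a Ee →
      R₂₃.lab-res e a (R₁₂.E⊆ e Ee) ⇔-∘ R₁₂.lab-res e a Ee
  ; Φ-res  = λ e →
      mk⇔ (λ h → let (h₂ , Ee) = to (R₁₂.Φ-res e) h in proj₁ (to (R₂₃.Φ-res e) h₂) , Ee)
          (λ (h₃ , Ee) → from (R₁₂.Φ-res e) (from (R₂₃.Φ-res e) (h₃ , R₁₂.E⊆ e Ee) , Ee))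
  }
  where
  module R₁₂ = _⊴_ ext₁₂
  module R₂₃ = _⊴_ ext₂₃

Comparable : {U A : Set} → BES U A → BES U A → Set₁
Comparable ℰ ℰ' = ℰ ⊴ ℰ' ⊎ ℰ' ⊴ ℰ

module _ {U A : Set} {ℰ ℰ' : BES U A} where
  private
    module S = BES ℰ
    module T = BES ℰ'

  #-transfer : Comparable ℰ ℰ' → ∀ {e f} → S.E e → S.E f → T._#_ e f → S._#_ e f
  #-transfer (inj₁ ext) Ee Ef h = from (_⊴_.#-res ext _ _ Ee Ef) h
  #-transfer (inj₂ ext) _ _ h = let (Ee , Ef) = T.#-in-E h in to (_⊴_.#-res ext _ _ Ee Ef) h

  ↦-transfer : Comparable ℰ ℰ' → ∀ {x e} → S.E e → T._↦_ x e → S._↦_ x e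
  ↦-transfer (inj₁ ext) Ee h = proj₂ (_⊴_.↦-res ext _ _ h Ee)
  ↦-transfer (inj₂ ext) _ h = _⊴_.↦⊆ ext _ _ h

  lab-transfer : Comparable ℰ ℰ' → ∀ {e a} → S.E e → T.lab e a → S.lab e a
  lab-transfer (inj₁ ext) Ee h = from (_⊴_.lab-res ext _ _ Ee) h
  lab-transfer (inj₂ ext) _ h = to (_⊴_.lab-res ext _ _ (T.lab-in-E h)) h

  Φ-transfer : Comparable ℰ ℰ' → ∀ {e} → S.E e → T.Φ e → S.Φ e
  Φ-transfer (inj₁ ext) Ee h = from (_⊴_.Φ-res ext _) (h , Ee)
  Φ-transfer (inj₂ ext) _ h = proj₁ (to (_⊴_.Φ-res ext _) h)

-- A trace of ℰ' consisting of events of ℰ is a trace of ℰ.  (Each group of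
-- lemmas is generic in ℰ and ℰ' so the next one can use it with the roles
-- of ℰ and ℰ' swapped.)
module _ {U A : Set} {ℰ ℰ' : BES U A} where
  private
    module S = BES ℰ
    module T = BES ℰ'

  trace-transfer : Comparable ℰ ℰ' → ∀ {σ} → IsTrace ℰ' σ → (_∈ σ) ⊆ S.E → IsTrace ℰ σ
  trace-transfer c []ᵗ _ = []ᵗ
  trace-transfer c (step {σ} {e} tr E'e e∉ noConflict bundled) σ⊆E =
    step (trace-transfer c tr (λ f m → σ⊆E f (∈-++⁺ˡ m))) (σ⊆E e (∈-++⁺ʳ σ (here refl))) e∉
      (λ f m h → noConflict f m (#-transfer (swap c) E'e (trace-in-E ℰ' tr f m) h))
      (λ z h → bundled z (↦-transfer (swap c) E'e h))

module _ {U A : Set} {ℰ ℰ' : BES U A} where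
  private
    module S = BES ℰ
    module T = BES ℰ'

  -- On a set of shared events both structures induce the same order ≼ₓ,
  -- since their traces through that set coincide.
  Prec-transfer : Comparable ℰ ℰ' → ∀ {x} → x ⊆ S.E → x ⊆ T.E → ∀ a b →
                  Prec ℰ x a b ⇔ Prec ℰ' x a b
  Prec-transfer c x⊆E x⊆E' a b = mk⇔
    (λ p σ tr en → p σ (trace-transfer c tr (λ e m → x⊆E e (from (en e) m))) en)
    (λ p σ tr en → p σ (trace-transfer (swap c) tr (λ e m → x⊆E' e (from (en e) m))) en)

  ∈𝓛-transfer : Comparable ℰ ℰ' → (P : LPoset U A) → LPoset.carrier P ⊆ S.E →
                P ∈𝓛 ℰ' → P ∈𝓛 ℰ
  ∈𝓛-transfer c P x⊆E (config@(σ , tr , en) , ord , lbl) =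
    (σ , trace-transfer c tr (λ e m → x⊆E e (from (en e) m)) , en) ,
    (λ a b xa xb → let ≼⇔ = Prec-transfer c x⊆E x⊆E' a b in
       (λ o → from ≼⇔ (proj₁ (ord a b xa xb) o)) ,
       (λ p → proj₂ (ord a b xa xb) (to ≼⇔ p))) ,
    (λ a l xa → mk⇔ (λ h → lab-transfer c (x⊆E a xa) (to (lbl a l xa) h))
                    (λ h → from (lbl a l xa) (lab-transfer (swap c) (x⊆E' a xa) h)))
    where
    x⊆E' : LPoset.carrier P ⊆ T.E
    x⊆E' = config-in-E ℰ' config

finite-bound : {U : Set} (S : ℕ → Subset U) → (∀ {i j} → i ≤ j → S i ⊆ S j) →
               (σ : List U) → (∀ e → e ∈ σ → ∃[ i ] S i e) → ∃[ i ] ((_∈ σ) ⊆ S i)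
finite-bound S mono [] _ = zero , λ e ()
finite-bound S mono (x ∷ σ) covered =
  let (i , σ⊆Sᵢ) = finite-bound S mono σ (λ e m → covered e (there m))
      (j , Sⱼx) = covered x (here refl)
      contained : (_∈ x ∷ σ) ⊆ S (i ⊔ j)
      contained = λ where
        e (here refl) → mono (m≤n⊔m i j) x Sⱼx
        e (there m) → mono (m≤m⊔n i j) e (σ⊆Sᵢ e m)
  in i ⊔ j , contained

module Chain {U A : Set} (𝓔 : ℕ → BES U A) (chain : ∀ i → 𝓔 i ⊴ 𝓔 (suc i)) where
  private
    module C (i : ℕ) = BES (𝓔 i)

  chain-mono′ : ∀ {i j} → i ≤′ j → 𝓔 i ⊴ 𝓔 j
  chain-mono′ ≤′-refl = ⊴-refl
  chain-mono′ (≤′-step i≤′j) = ⊴-trans (chain-mono′ i≤′j) (chain _)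

  chain-mono : ∀ {i j} → i ≤ j → 𝓔 i ⊴ 𝓔 j
  chain-mono i≤j = chain-mono′ (≤⇒≤′ i≤j)

  comparable : ∀ i j → Comparable (𝓔 i) (𝓔 j)
  comparable i j with ≤-total i j
  ... | inj₁ i≤j = inj₁ (chain-mono i≤j)
  ... | inj₂ j≤i = inj₂ (chain-mono j≤i)

  module _ (ℒ : BES U A) (lim : IsLimit 𝓔 ℒ) where
    open IsLimit lim using (E-lim; #-lim; ↦-lim; lab-lim; Φ-lim)

    upper-bound : ∀ i → 𝓔 i ⊴ ℒ
    upper-bound i = record
      { E⊆     = λ e h → from (E-lim e) (i , h)
      ; #-res  = λ e f Ee Ef → mk⇔ (λ h → from (#-lim e f) (i , h))
          (λ h → let (j , hⱼ) = to (#-lim e f) h in #-transfer (comparable i j) Ee Ef hⱼ)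
      ; ↦⊆     = λ x e h → from (↦-lim x e) (i , h)
      ; ↦-res  = λ x e h Ee →
          let (j , hⱼ) = to (↦-lim x e) h
              hᵢ = ↦-transfer (comparable i j) Ee hⱼ
          in C.↦-source-E i hᵢ , hᵢ
      ; lab-res = λ e a Ee → mk⇔ (λ h → from (lab-lim e a) (i , h))
          (λ h → let (j , hⱼ) = to (lab-lim e a) h in lab-transfer (comparable i j) Ee hⱼ)
      ; Φ-res  = λ e → mk⇔ (λ h → from (Φ-lim e) (i , h) , C.Φ-in-E i h)
          (λ (h , Ee) → let (j , hⱼ) = to (Φ-lim e) h in Φ-transfer (comparable i j) Ee hⱼ)
      }

    config-bound : ∀ {x} → IsConfig ℒ x → ∃[ i ] (x ⊆ C.E i)
    config-bound (σ , tr , en) =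
      let (i , σ⊆Eᵢ) = finite-bound C.E (λ i≤j → _⊴_.E⊆ (chain-mono i≤j)) σ
                         (λ e m → to (E-lim e) (trace-in-E ℒ tr e m))
      in i , λ e xe → σ⊆Eᵢ e (to (en e) xe)

corollary2 : {U A : Set} (𝓔 : ℕ → BES U A) → (∀ i → 𝓔 i ⊴ 𝓔 (suc i))
    → (ℒ : BES U A) → IsLimit 𝓔 ℒ
    → (P : LPoset U A) → (P ∈𝓛 ℒ ⇔ (∃[ i ] (P ∈𝓛 𝓔 i)))
corollary2 𝓔 chain ℒ lim P = mk⇔ fromLimit toLimit
  where
  open Chain 𝓔 chain

  fromLimit : P ∈𝓛 ℒ → ∃[ i ] (P ∈𝓛 𝓔 i)
  fromLimit P∈ℒ@(config , _) =
    let (i , x⊆Eᵢ) = config-bound ℒ lim config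
    in i , ∈𝓛-transfer (inj₁ (upper-bound ℒ lim i)) P x⊆Eᵢ P∈ℒ

  toLimit : ∃[ i ] (P ∈𝓛 𝓔 i) → P ∈𝓛 ℒ
  toLimit (i , P∈𝓔ᵢ@(config , _)) =
    ∈𝓛-transfer (inj₂ (upper-bound ℒ lim i)) P
      (λ e xe → _⊴_.E⊆ (upper-bound ℒ lim i) e (config-in-E (𝓔 i) config e xe)) P∈𝓔ᵢ
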